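{- Let $n\geq3$, $k\geq3$ and $c\mid n$. (i) Suppose $(a_0,a_1,\dots,a_{n-1})$ is a $k$-ary $n$-tuple with $a_{i}=a_{i+c}$ for every $0\leq i\leq n-c-1$. Then $(a_0,\dots,a_{n-1})$ is a negasymmetric $n$-tuple if and only if $(a_0,\dots,a_{c-1})$ is a negasymmetric $c$-tuple. Moreover, in this case, if $c$ is odd then $a_{(c-1)/2}=0$ or $a_{(c-1)/2}=k/2$ (the latter possible only if $k$ is even). (ii) Suppose $[a_0,a_1,\dots,a_{n-1}]$ is a circuit in $B_k(n-1)$ of period dividing $c$. Then $[a_0,\dots,a_{n-1}]$ is a negasymmetric circuit in $B_k(n-1)$ if and only if $[a_0,\dots,a_{c-1}]$ is a negasymmetric circuit in $B_k(c-1)$. Moreover, $[a_0,\dots,a_{n-1}]$ is a negasymmetric circuit in $H_k(n-1)$ if and only if $[a_0,\dots,a_{c-1}]$ is a negasymmetric circuit in $H_k(c-1)$.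
   Context: Tuples are $k$-ary (entries in $\mathbb{Z}_k$), negation is modulo $k$, $\mathbf{u}^R$ is the reverse of $\mathbf{u}$; a tuple $\mathbf{u}$ is negasymmetric if $\mathbf{u}=-\mathbf{u}^R$. The pseudoweight of $a\in\mathbb{Z}_k$ is $a$ if $a\ne0$ and $k/2$ if $a=0$, and of a tuple the sum over its entries. For $N\ge1$, $B_k(N-1)$ is the de Bruijn digraph with vertices the $k$-ary $(N-1)$-tuples and edges the $k$-ary $N$-tuples $(a_0,\dots,a_{N-1})$ from $(a_0,\dots,a_{N-2})$ to $(a_1,\dots,a_{N-1})$; $H_k(N-1)$ is its subgraph of edges of pseudoweight exactly $kN/2$. For an $N$-tuple $(a_0,\dots,a_{N-1})$, with $p$ the least positive $d$ such that $a_i=a_{(i+d)\bmod N}$ for all $i$, $[a_0,\dots,a_{N-1}]$ is the circuit in $B_k(N-1)$ whose edges are the $p$ cyclic shifts $(a_j,\dots,a_{j+N-1})$ (indices mod $N$), $0\le j<p$; $p$ is its period. A circuit is negasymmetric if it contains edges $\mathbf a,\mathbf b$ (not necessarily distinct) with $\mathbf a=-\mathbf b^R$. -}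

module Defs where

open import Data.Nat using (ℕ; zero; suc; _+_; _*_; _∸_; _≤_; _<_; NonZero)
open import Data.Nat.DivMod using (_%_; m%n<n)
open import Data.Nat.Divisibility using (_∣_; ∣⇒≤)
open import Data.Fin using (Fin; zero; suc; toℕ; fromℕ<; inject≤; opposite)
open import Data.Product using (Σ; _×_; ∃)
open import Relation.Binary.PropositionalEquality using (_≡_)

-- k-ary N-tuples are functions Fin N → Fin k (entries in ℤ_k).
Tuple : ℕ → ℕ → Set
Tuple k N = Fin N → Fin k

_≐_ : ∀ {k N} → Tuple k N → Tuple k N → Set
u ≐ v = ∀ i → u i ≡ v i

neg : ∀ {k} → Fin k → Fin k
neg {suc k} a = fromℕ< (m%n<n (suc k ∸ toℕ a) (suc k))

negT : ∀ {k N} → Tuple k N → Tuple k N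
negT u i = neg (u i)

rev : ∀ {k N} → Tuple k N → Tuple k N
rev u i = u (opposite i)

NegaSym : ∀ {k N} → Tuple k N → Set
NegaSym u = u ≐ negT (rev u)

prefix : ∀ {k c n} → c ≤ n → Tuple k n → Tuple k c
prefix c≤n a i = a (inject≤ i c≤n)

∣⇒≤3 : ∀ {c n} → c ∣ n → 3 ≤ n → c ≤ n
∣⇒≤3 {n = suc n} c∣n _ = ∣⇒≤ c∣n

-- index m mod N (the Fin N argument witnesses N ≠ 0)
wrap : ∀ {N} → Fin N → ℕ → Fin N
wrap {suc N} _ m = fromℕ< (m%n<n m (suc N))

shift : ∀ {k N} → Tuple k N → ℕ → Tuple k N
shift a j i = a (wrap i (j + toℕ i))

Invariant : ∀ {k N} → Tuple k N → ℕ → Set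
Invariant a d = ∀ i → a i ≡ a (wrap i (toℕ i + d))

Period : ∀ {k N} → Tuple k N → ℕ → Set
Period a p = (0 < p) × Invariant a p × (∀ d → 0 < d → Invariant a d → p ≤ d)

-- e is an edge of the circuit [a_0,...,a_{N-1}] in B_k(N-1):
-- e is one of the p cyclic shifts of a, 0 ≤ j < p, p the period
InCircuit : ∀ {k N} → Tuple k N → Tuple k N → Set
InCircuit a e = Σ ℕ λ p → Period a p × Σ ℕ λ j → j < p × (e ≐ shift a j)

NegaSymCircuit : ∀ {k N} → Tuple k N → Set
NegaSymCircuit a = ∃ λ e → ∃ λ f → InCircuit a e × InCircuit a f × (e ≐ negT (rev f))

-- twice the pseudoweight of an entry: 2·(k/2)=k if a=0, else 2a
pw2 : ∀ {k} → Fin k → ℕ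
pw2 {k} zero = k
pw2 (suc a) = 2 * suc (toℕ a)

sumFin : ∀ {N} → (Fin N → ℕ) → ℕ
sumFin {zero} f = 0
sumFin {suc N} f = f zero + sumFin (λ i → f (suc i))

pw2T : ∀ {k N} → Tuple k N → ℕ
pw2T u = sumFin (λ i → pw2 (u i))

-- e is an edge of H_k(N-1): pseudoweight exactly kN/2 (doubled: kN)
InH : ∀ {k N} → Tuple k N → Set
InH {k} {N} e = pw2T e ≡ k * N

CircuitInH : ∀ {k N} → Tuple k N → Set
CircuitInH a = ∀ e → InCircuit a e → InH e

{-# OPTIONS --safe #-}

-- A tuple with a_i = a_{i+c} is constant on residue classes modulo c, and since c ∣ n the reversal
-- i ↦ n-1-i of Fin n induces on residues the same map as the reversal i ↦ c-1-i of Fin c. Hence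
-- a = -aᴿ holds iff it holds for the first c entries, and for odd c the middle entry x satisfies
-- x = -x, i.e. x = 0 or 2x = k. If the circuit has period p ∣ c, the tuple is c-periodic, its prefix
-- has the same shift-invariances and so the same period p, and the j-th shift of the prefix is the
-- prefix of the j-th shift: edges correspond one to one, negasymmetry transfers as above, and each
-- edge has n/c times the pseudoweight of its prefix, the same factor as between kn/2 and kc/2.

module Submission where

open import Defs
open import Data.Nat using (ℕ; zero; suc; _+_; _*_; _∸_; _≤_; _<_; NonZero)
open import Data.Nat.Properties
  using ( +-identityʳ; +-comm; +-assoc; *-assoc; +-cancelˡ-≡; +-cancelʳ-≡; *-cancelˡ-≡; m*n≢0⇒m≢0
        ; m≤m+n; ≤-<-trans; ≤-antisym; <⇒≤; m∸n+n≡m; m+[n∸m]≡n; m∸n≤m)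
open import Data.Nat.DivMod using (_%_; _/_; m%n<n; m≡m%n+[m/n]*n; m<n⇒m%n≡m; m≤n⇒m%n≡m)
open import Data.Nat.Divisibility using (_∣_; divides-refl; ∣-refl; 0∣⇒≡0)
open import Data.Nat.Tactic.RingSolver using (solve; solve-∀)
open import Data.Fin using (Fin; zero; suc; toℕ; fromℕ<; inject≤; opposite; _↑ˡ_; _↑ʳ_)
open import Data.Fin.Properties
  using (toℕ-injective; toℕ-fromℕ<; toℕ-inject≤; opposite-prop; toℕ<n; toℕ-↑ˡ; toℕ-↑ʳ)
open import Data.List using (_∷_; [])
open import Data.Product using (Σ; _×_; _,_; ∃-syntax; ∃₂)
open import Data.Product.Function.NonDependent.Propositional using (_×-⇔_)
open import Data.Sum using (_⊎_; inj₁; inj₂)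
open import Function using (_∘_)
open import Function.Bundles using (_⇔_; mk⇔; Equivalence)
import Function.Properties.Equivalence as ⇔
open import Level using (0ℓ)
open import Relation.Binary.Bundles using (Setoid)
open import Relation.Binary.PropositionalEquality
  using (_≡_; refl; sym; trans; cong; cong₂; subst; _≗_; module ≡-Reasoning)

private variable
  A : Set
  k n m c d p : ℕ

-- Congruence modulo d, phrased without truncated subtraction or division.
infix 4 _≡_mod_

_≡_mod_ : ℕ → ℕ → ℕ → Set
x ≡ y mod d = ∃₂ λ s t → x + s * d ≡ y + t * d

mod-refl : ∀ {x d} → x ≡ x mod d
mod-refl = 0 , 0 , refl

mod-reflexive : ∀ {x y d} → x ≡ y → x ≡ y mod d
mod-reflexive refl = mod-refl

mod-sym : ∀ {x y d} → x ≡ y mod d → y ≡ x mod d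
mod-sym (s , t , eq) = t , s , sym eq

mod-trans : ∀ {x y z d} → x ≡ y mod d → y ≡ z mod d → x ≡ z mod d
mod-trans {x} {y} {z} {d} (s , t , x≡y) (s′ , t′ , y≡z) = s + s′ , t′ + t , (begin
  x + (s + s′) * d    ≡⟨ solve (x ∷ s ∷ s′ ∷ d ∷ []) ⟩
  x + s * d + s′ * d  ≡⟨ cong (_+ s′ * d) x≡y ⟩
  y + t * d + s′ * d  ≡⟨ solve (y ∷ t ∷ s′ ∷ d ∷ []) ⟩
  y + s′ * d + t * d  ≡⟨ cong (_+ t * d) y≡z ⟩
  z + t′ * d + t * d  ≡⟨ solve (z ∷ t′ ∷ t ∷ d ∷ []) ⟩
  z + (t′ + t) * d    ∎)
  where open ≡-Reasoning

mod-setoid : ℕ → Setoid 0ℓ 0ℓ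
mod-setoid d = record
  { Carrier       = ℕ
  ; _≈_           = _≡_mod d
  ; isEquivalence = record { refl = mod-refl ; sym = mod-sym ; trans = mod-trans }
  }

module ≡-mod-Reasoning (d : ℕ) where
  open import Relation.Binary.Reasoning.Setoid (mod-setoid d) public

mod-+-cong : ∀ {x y u v d} → x ≡ y mod d → u ≡ v mod d → x + u ≡ y + v mod d
mod-+-cong {x} {y} {u} {v} {d} (s , t , x≡y) (s′ , t′ , u≡v) = s + s′ , t + t′ , (begin
  x + u + (s + s′) * d        ≡⟨ solve (x ∷ u ∷ s ∷ s′ ∷ d ∷ []) ⟩
  (x + s * d) + (u + s′ * d)  ≡⟨ cong₂ _+_ x≡y u≡v ⟩
  (y + t * d) + (v + t′ * d)  ≡⟨ solve (y ∷ v ∷ t ∷ t′ ∷ d ∷ []) ⟩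
  y + v + (t + t′) * d        ∎)
  where open ≡-Reasoning

mod-+-cancelʳ : ∀ {x y u v d} → x + u ≡ y + v mod d → u ≡ v mod d → x ≡ y mod d
mod-+-cancelʳ {x} {y} {u} {v} {d} (s , t , eq) (s′ , t′ , u≡v) =
  s + t′ , t + s′ , +-cancelʳ-≡ (u + s′ * d) _ _ (begin
    x + (s + t′) * d + (u + s′ * d)  ≡⟨ solve (x ∷ u ∷ s ∷ s′ ∷ t′ ∷ d ∷ []) ⟩
    x + u + s * d + (s′ + t′) * d    ≡⟨ cong (_+ (s′ + t′) * d) eq ⟩
    y + v + t * d + (s′ + t′) * d    ≡⟨ solve (y ∷ v ∷ t ∷ s′ ∷ t′ ∷ d ∷ []) ⟩
    y + (t + s′) * d + (v + t′ * d)  ≡⟨ cong (y + (t + s′) * d +_) u≡v ⟨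
    y + (t + s′) * d + (u + s′ * d)  ∎)
  where open ≡-Reasoning

mod-∣ : ∀ {x y} → d ∣ c → x ≡ y mod c → x ≡ y mod d
mod-∣ {d} {x = x} {y} (divides-refl q) (s , t , eq) = s * q , t * q ,
  trans (cong (x +_) (*-assoc s q d)) (trans eq (cong (y +_) (sym (*-assoc t q d))))

∣⇒≡0-mod : d ∣ n → n ≡ 0 mod d
∣⇒≡0-mod (divides-refl q) = 0 , q , +-identityʳ _

d+x≡x-mod : ∀ x → d + x ≡ x mod d
d+x≡x-mod {d} x = 0 , 1 , solve (d ∷ x ∷ [])

x%d≡x-mod : ∀ x d .{{_ : NonZero d}} → x % d ≡ x mod d
x%d≡x-mod x d = x / d , 0 , trans (sym (m≡m%n+[m/n]*n x d)) (sym (+-identityʳ x))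

StepInvariant : ℕ → (Fin n → A) → Set
StepInvariant d a = ∀ i j → toℕ j ≡ toℕ i + d → a i ≡ a j

Periodic : ℕ → (Fin n → A) → Set
Periodic d a = ∀ i j → toℕ i ≡ toℕ j mod d → a i ≡ a j

StepInvariant-iterate : {a : Fin n → A} → StepInvariant d a →
                        ∀ t {i j} → toℕ j ≡ toℕ i + t * d → a i ≡ a j
StepInvariant-iterate {a = a} step zero {i} {j} j≡i+0 =
  cong a (toℕ-injective (sym (trans j≡i+0 (+-identityʳ (toℕ i)))))
StepInvariant-iterate {n = n} {d = d} {a = a} step (suc t) {i} {j} j≡i+[1+t]d =
  trans (StepInvariant-iterate step t (toℕ-fromℕ< i+td<n))
        (step i′ j (trans j≡i+td+d (cong (_+ d) (sym (toℕ-fromℕ< i+td<n)))))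
  where
  j≡i+td+d : toℕ j ≡ toℕ i + t * d + d
  j≡i+td+d = trans j≡i+[1+t]d
    (trans (cong (toℕ i +_) (+-comm d (t * d))) (sym (+-assoc (toℕ i) (t * d) d)))
  i+td<n : toℕ i + t * d < n
  i+td<n = ≤-<-trans (m≤m+n _ d) (subst (_< n) j≡i+td+d (toℕ<n j))
  i′ : Fin n
  i′ = fromℕ< i+td<n

StepInvariant⇒Periodic : {a : Fin n → A} → StepInvariant d a → Periodic d a
StepInvariant⇒Periodic {d = d} {a = a} step i j (s , t , eq) = go s t eq
  where
  go : ∀ s t → toℕ i + s * d ≡ toℕ j + t * d → a i ≡ a j
  go zero t eq = sym (StepInvariant-iterate step t (trans (sym (+-identityʳ (toℕ i))) eq))
  go (suc s) zero eq = StepInvariant-iterate step (suc s) (trans (sym (+-identityʳ (toℕ j))) (sym eq))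
  go (suc s) (suc t) eq =
    go s t (+-cancelˡ-≡ d _ _ (trans (swap (toℕ i) s) (trans eq (sym (swap (toℕ j) t)))))
    where
    swap : ∀ x s → d + (x + s * d) ≡ x + suc s * d
    swap x s = solve (d ∷ x ∷ s ∷ [])

Periodic-∣ : {a : Fin n → A} → d ∣ c → Periodic d a → Periodic c a
Periodic-∣ d∣c periodic i j i≡j = periodic i j (mod-∣ d∣c i≡j)

inject≤-mod : (le : c ≤ n) (i : Fin c) → toℕ (inject≤ i le) ≡ toℕ i mod c
inject≤-mod le i = mod-reflexive (toℕ-inject≤ i le)

Periodic-prefix : {a : Tuple k n} → Periodic c a → (le : c ≤ n) →
                  (i : Fin n) (j : Fin c) → toℕ i ≡ toℕ j mod c → a i ≡ prefix le a j
Periodic-prefix periodic le i j i≡j = periodic i _ (mod-trans i≡j (mod-sym (inject≤-mod le j)))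

residue : .{{_ : NonZero c}} → Fin n → Fin c
residue {c} i = fromℕ< (m%n<n (toℕ i) c)

residue-mod : .{{_ : NonZero c}} (i : Fin n) → toℕ i ≡ toℕ (residue {c} i) mod c
residue-mod {c} i = mod-sym (mod-trans (mod-reflexive (toℕ-fromℕ< _)) (x%d≡x-mod (toℕ i) c))

opposite+suc : (i : Fin n) → toℕ (opposite i) + suc (toℕ i) ≡ n
opposite+suc i = trans (cong (_+ suc (toℕ i)) (opposite-prop i)) (m∸n+n≡m (toℕ<n i))

opposite-mod : c ∣ n → c ∣ m → (i : Fin n) (j : Fin m) →
               toℕ i ≡ toℕ j mod c → toℕ (opposite i) ≡ toℕ (opposite j) mod c
opposite-mod {c} {n} {m} c∣n c∣m i j i≡j = mod-+-cancelʳ (begin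
    toℕ (opposite i) + suc (toℕ i)  ≡⟨ opposite+suc i ⟩
    n                               ≈⟨ ∣⇒≡0-mod c∣n ⟩
    0                               ≈⟨ ∣⇒≡0-mod c∣m ⟨
    m                               ≡⟨ opposite+suc j ⟨
    toℕ (opposite j) + suc (toℕ j)  ∎)
  (mod-+-cong {1} mod-refl i≡j)
  where open ≡-mod-Reasoning c

opposite-middle : c ∣ n → (i : Fin n) → 2 * toℕ i + 1 ≡ c → toℕ (opposite i) ≡ toℕ i mod c
opposite-middle {c} {n} c∣n i 2i+1≡c = mod-+-cancelʳ (begin
    toℕ (opposite i) + suc (toℕ i)  ≡⟨ opposite+suc i ⟩
    n                               ≈⟨ ∣⇒≡0-mod c∣n ⟩
    0                               ≈⟨ ∣⇒≡0-mod ∣-refl ⟨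
    c                               ≡⟨ 2i+1≡c ⟨
    2 * toℕ i + 1                   ≡⟨ twice+1 (toℕ i) ⟩
    toℕ i + suc (toℕ i)             ∎)
  mod-refl
  where
  open ≡-mod-Reasoning c
  twice+1 : ∀ x → 2 * x + 1 ≡ x + suc x
  twice+1 = solve-∀

neg-fixedPoint : (x : Fin k) → x ≡ neg x → toℕ x ≡ 0 ⊎ 2 * toℕ x ≡ k
neg-fixedPoint {suc k} zero _ = inj₁ refl
neg-fixedPoint {suc k} (suc y) y+1≡-[y+1] = inj₂ (begin
  2 * suc (toℕ y)              ≡⟨ cong (λ z → suc (toℕ y + z)) (+-identityʳ _) ⟩
  suc (toℕ y + suc (toℕ y))    ≡⟨ cong (λ z → suc (toℕ y + z)) y+1≡k-y ⟩
  suc (toℕ y + (k ∸ toℕ y))    ≡⟨ cong suc (m+[n∸m]≡n (<⇒≤ (toℕ<n y))) ⟩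
  suc k                        ∎)
  where
  open ≡-Reasoning
  y+1≡k-y : suc (toℕ y) ≡ k ∸ toℕ y
  y+1≡k-y = trans (cong toℕ y+1≡-[y+1]) (trans (toℕ-fromℕ< _) (m≤n⇒m%n≡m (m∸n≤m k (toℕ y))))

prefix-negRev : .{{_ : NonZero c}} → c ∣ n → (le : c ≤ n) {u v : Tuple k n} →
                Periodic c u → Periodic c v →
                u ≐ negT (rev v) ⇔ prefix le u ≐ negT (rev (prefix le v))
prefix-negRev {c} c∣n le {u} {v} u-periodic v-periodic = mk⇔ to from
  where
  to : u ≐ negT (rev v) → prefix le u ≐ negT (rev (prefix le v))
  to u≐-vᴿ i = trans (u≐-vᴿ (inject≤ i le))
    (cong neg (Periodic-prefix v-periodic le _ _ (opposite-mod c∣n ∣-refl _ i (inject≤-mod le i))))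
  from : prefix le u ≐ negT (rev (prefix le v)) → u ≐ negT (rev v)
  from u≐-vᴿ i = trans (Periodic-prefix u-periodic le i r (residue-mod i))
    (trans (u≐-vᴿ r) (cong neg (sym (Periodic-prefix v-periodic le _ _
      (opposite-mod c∣n ∣-refl i r (residue-mod i))))))
    where
    r : Fin c
    r = residue i

NegaSym-middle : {a : Tuple k n} → c ∣ n → Periodic c a → NegaSym a →
                 (i : Fin n) → 2 * toℕ i + 1 ≡ c → toℕ (a i) ≡ 0 ⊎ 2 * toℕ (a i) ≡ k
NegaSym-middle {a = a} c∣n periodic negaSym i 2i+1≡c =
  neg-fixedPoint (a i) (trans (negaSym i) (cong neg (periodic _ _ (opposite-middle c∣n i 2i+1≡c))))

wrap-mod : (i : Fin n) (x : ℕ) → toℕ (wrap i x) ≡ x mod n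
wrap-mod {suc n} i x = mod-trans (mod-reflexive (toℕ-fromℕ< _)) (x%d≡x-mod x (suc n))

wrap-< : ∀ {x} (i : Fin n) → x < n → toℕ (wrap i x) ≡ x
wrap-< {suc n} i x<n = trans (toℕ-fromℕ< _) (m<n⇒m%n≡m x<n)

wrap-cong : ∀ {x y} → c ∣ n → c ∣ m → (i : Fin n) (j : Fin m) →
            x ≡ y mod c → toℕ (wrap i x) ≡ toℕ (wrap j y) mod c
wrap-cong {c} {x = x} {y} c∣n c∣m i j x≡y = begin
  toℕ (wrap i x)  ≈⟨ mod-∣ c∣n (wrap-mod i x) ⟩
  x               ≈⟨ x≡y ⟩
  y               ≈⟨ mod-∣ c∣m (wrap-mod j y) ⟨
  toℕ (wrap j y)  ∎
  where open ≡-mod-Reasoning c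

Invariant⇒StepInvariant : {a : Tuple k n} → Invariant a d → StepInvariant d a
Invariant⇒StepInvariant {a = a} invariant i j j≡i+d = trans (invariant i)
  (cong a (toℕ-injective (trans (wrap-< i (subst (_< _) j≡i+d (toℕ<n j))) (sym j≡i+d))))

shift-Periodic : {a : Tuple k n} → c ∣ n → Periodic c a → ∀ j → Periodic c (shift a j)
shift-Periodic c∣n periodic j i i′ i≡i′ =
  periodic _ _ (wrap-cong c∣n c∣n i i′ (mod-+-cong {j} mod-refl i≡i′))

prefix-shift : {a : Tuple k n} → c ∣ n → (le : c ≤ n) → Periodic c a →
               ∀ j → prefix le (shift a j) ≐ shift (prefix le a) j
prefix-shift c∣n le periodic j i = Periodic-prefix periodic le _ _
  (wrap-cong c∣n ∣-refl (inject≤ i le) i (mod-+-cong {j} mod-refl (inject≤-mod le i)))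

prefix-Invariant : .{{_ : NonZero c}} {a : Tuple k n} → c ∣ n → (le : c ≤ n) → Periodic c a →
                   Invariant a d ⇔ Invariant (prefix le a) d
prefix-Invariant {c} {a = a} c∣n le periodic = mk⇔ to from
  where
  to : Invariant a _ → Invariant (prefix le a) _
  to invariant i = trans (invariant (inject≤ i le)) (Periodic-prefix periodic le _ _
    (wrap-cong c∣n ∣-refl _ i (mod-+-cong (inject≤-mod le i) mod-refl)))
  from : Invariant (prefix le a) _ → Invariant a _
  from invariant i = trans (Periodic-prefix periodic le i r (residue-mod i))
    (trans (invariant r) (sym (Periodic-prefix periodic le _ _
      (wrap-cong c∣n ∣-refl i r (mod-+-cong (residue-mod i) mod-refl)))))
    where
    r : Fin c
    r = residue i

prefix-Period : .{{_ : NonZero c}} {a : Tuple k n} → c ∣ n → (le : c ≤ n) → Periodic c a →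
                Period a p → Period (prefix le a) p
prefix-Period c∣n le periodic (0<p , invariant , least) =
  0<p , Equivalence.to (prefix-Invariant c∣n le periodic) invariant ,
  λ d 0<d invariantᵇ → least d 0<d (Equivalence.from (prefix-Invariant c∣n le periodic) invariantᵇ)

Period-unique : ∀ {a : Tuple k n} {p p′} → Period a p → Period a p′ → p ≡ p′
Period-unique (0<p , inv-p , least-p) (0<p′ , inv-p′ , least-p′) =
  ≤-antisym (least-p _ 0<p′ inv-p′) (least-p′ _ 0<p inv-p)

InCircuit⇔shift : {a e : Tuple k n} → Period a p → InCircuit a e ⇔ (∃[ j ] j < p × e ≐ shift a j)
InCircuit⇔shift period = mk⇔
  (λ (p′ , period′ , j , j<p′ , e≐) → j , subst (j <_) (Period-unique period′ period) j<p′ , e≐)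
  (λ (j , j<p , e≐) → _ , period , j , j<p , e≐)

≐-negRev : {u u′ v v′ : Tuple k n} → u ≐ u′ → v ≐ v′ → u ≐ negT (rev v) → u′ ≐ negT (rev v′)
≐-negRev u≐u′ v≐v′ u≐-vᴿ i = trans (sym (u≐u′ i)) (trans (u≐-vᴿ i) (cong neg (v≐v′ (opposite i))))

≐-sym : {u v : Tuple k n} → u ≐ v → v ≐ u
≐-sym u≐v i = sym (u≐v i)

NegaSymShifts : ℕ → Tuple k n → Set
NegaSymShifts p a = ∃₂ λ j j′ → j < p × j′ < p × shift a j ≐ negT (rev (shift a j′))

NegaSymCircuit⇔NegaSymShifts : {a : Tuple k n} → Period a p → NegaSymCircuit a ⇔ NegaSymShifts p a
NegaSymCircuit⇔NegaSymShifts period = mk⇔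
  (λ (e , f , e∈a , f∈a , e≐-fᴿ) →
    let (j , j<p , e≐) = Equivalence.to (InCircuit⇔shift period) e∈a
        (j′ , j′<p , f≐) = Equivalence.to (InCircuit⇔shift period) f∈a
    in j , j′ , j<p , j′<p , ≐-negRev e≐ f≐ e≐-fᴿ)
  (λ (j , j′ , j<p , j′<p , shifts≐) →
    _ , _ , Equivalence.from (InCircuit⇔shift period) (j , j<p , λ _ → refl) ,
    Equivalence.from (InCircuit⇔shift period) (j′ , j′<p , λ _ → refl) , shifts≐)

prefix-NegaSymShifts : .{{_ : NonZero c}} {a : Tuple k n} → c ∣ n → (le : c ≤ n) → Periodic c a →
                       NegaSymShifts p a ⇔ NegaSymShifts p (prefix le a)
prefix-NegaSymShifts {a = a} c∣n le periodic = mk⇔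
  (λ (j , j′ , j<p , j′<p , shifts≐) → j , j′ , j<p , j′<p ,
    ≐-negRev (shift-prefix j) (shift-prefix j′) (Equivalence.to (shift-negRev j j′) shifts≐))
  (λ (j , j′ , j<p , j′<p , shifts≐) → j , j′ , j<p , j′<p ,
    Equivalence.from (shift-negRev j j′)
      (≐-negRev (≐-sym (shift-prefix j)) (≐-sym (shift-prefix j′)) shifts≐))
  where
  shift-prefix : ∀ j → prefix le (shift a j) ≐ shift (prefix le a) j
  shift-prefix = prefix-shift c∣n le periodic
  shift-negRev : ∀ j j′ → shift a j ≐ negT (rev (shift a j′))
                        ⇔ prefix le (shift a j) ≐ negT (rev (prefix le (shift a j′)))
  shift-negRev j j′ =
    prefix-negRev c∣n le (shift-Periodic c∣n periodic j) (shift-Periodic c∣n periodic j′)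

prefix-NegaSymCircuit : .{{_ : NonZero c}} {a : Tuple k n} → c ∣ n → (le : c ≤ n) → Periodic c a →
                        Period a p → NegaSymCircuit a ⇔ NegaSymCircuit (prefix le a)
prefix-NegaSymCircuit c∣n le periodic period =
  ⇔.trans (NegaSymCircuit⇔NegaSymShifts period)
  (⇔.trans (prefix-NegaSymShifts c∣n le periodic)
  (⇔.sym (NegaSymCircuit⇔NegaSymShifts (prefix-Period c∣n le periodic period))))

sumFin-cong : {f g : Fin n → ℕ} → f ≗ g → sumFin f ≡ sumFin g
sumFin-cong {zero} f≗g = refl
sumFin-cong {suc n} f≗g = cong₂ _+_ (f≗g zero) (sumFin-cong (f≗g ∘ suc))

sumFin-++ : ∀ m {n} (f : Fin (m + n) → ℕ) →
            sumFin f ≡ sumFin (f ∘ (_↑ˡ n)) + sumFin (f ∘ (m ↑ʳ_))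
sumFin-++ zero f = refl
sumFin-++ (suc m) f = trans (cong (f zero +_) (sumFin-++ m (f ∘ suc))) (sym (+-assoc (f zero) _ _))

sumFin-periodic : ∀ q (f : Fin (q * c) → ℕ) (g : Fin c → ℕ) →
                  (∀ i j → toℕ i ≡ toℕ j mod c → f i ≡ g j) → sumFin f ≡ q * sumFin g
sumFin-periodic zero f g f~g = refl
sumFin-periodic {c} (suc q) f g f~g = trans (sumFin-++ c f) (cong₂ _+_
  (sumFin-cong λ i → f~g _ i (mod-reflexive (toℕ-↑ˡ i (q * c))))
  (sumFin-periodic q (f ∘ (c ↑ʳ_)) g λ i j i≡j →
    f~g _ j (mod-trans (mod-trans (mod-reflexive (toℕ-↑ʳ c i)) (d+x≡x-mod (toℕ i))) i≡j)))

pw2T-prefix : ∀ q (le : c ≤ q * c) {u : Tuple k (q * c)} → Periodic c u →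
              pw2T u ≡ q * pw2T (prefix le u)
pw2T-prefix q le periodic =
  sumFin-periodic q _ _ λ i j i≡j → cong pw2 (Periodic-prefix periodic le i j i≡j)

InH-resp : {u v : Tuple k n} → u ≐ v → InH u → InH v
InH-resp u≐v inH = trans (sym (sumFin-cong (cong pw2 ∘ u≐v))) inH

InH-prefix : .{{_ : NonZero n}} {u : Tuple k n} → c ∣ n → (le : c ≤ n) → Periodic c u →
             InH u ⇔ InH (prefix le u)
InH-prefix {k = k} {c = c} (divides-refl q) le periodic = mk⇔
  (λ inH → *-cancelˡ-≡ _ _ q ⦃ q≢0 ⦄
    (trans (sym (pw2T-prefix q le periodic)) (trans inH (kqc≡qkc k q c))))
  (λ inHᵇ → trans (pw2T-prefix q le periodic) (trans (cong (q *_) inHᵇ) (sym (kqc≡qkc k q c))))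
  where
  q≢0 : NonZero q
  q≢0 = m*n≢0⇒m≢0 q
  kqc≡qkc : ∀ k q c → k * (q * c) ≡ q * (k * c)
  kqc≡qkc = solve-∀

CircuitInH⇔shifts : {a : Tuple k n} → Period a p → CircuitInH a ⇔ (∀ j → j < p → InH (shift a j))
CircuitInH⇔shifts period = mk⇔
  (λ inH j j<p → inH _ (Equivalence.from (InCircuit⇔shift period) (j , j<p , λ _ → refl)))
  (λ inH e e∈a → let (j , j<p , e≐) = Equivalence.to (InCircuit⇔shift period) e∈a in
    InH-resp (≐-sym e≐) (inH j j<p))

prefix-CircuitInH : .{{_ : NonZero c}} .{{_ : NonZero n}} {a : Tuple k n} → c ∣ n → (le : c ≤ n) →
                    Periodic c a → Period a p → CircuitInH a ⇔ CircuitInH (prefix le a)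
prefix-CircuitInH {a = a} c∣n le periodic period =
  ⇔.trans (CircuitInH⇔shifts period)
  (⇔.trans (mk⇔ (λ inH j j<p → Equivalence.to (shift-InH j) (inH j j<p))
                (λ inH j j<p → Equivalence.from (shift-InH j) (inH j j<p)))
  (⇔.sym (CircuitInH⇔shifts (prefix-Period c∣n le periodic period))))
  where
  shift-InH : ∀ j → InH (shift a j) ⇔ InH (shift (prefix le a) j)
  shift-InH j = ⇔.trans (InH-prefix c∣n le (shift-Periodic c∣n periodic j))
    (mk⇔ (InH-resp (prefix-shift c∣n le periodic j))
         (InH-resp (≐-sym (prefix-shift c∣n le periodic j))))

lemma2p6 : (n k c : ℕ) → (n≥3 : 3 ≤ n) → 3 ≤ k → (c∣n : c ∣ n) →
    ((a : Tuple k n) →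
      (∀ (i j : Fin n) → toℕ j ≡ toℕ i + c → a i ≡ a j) →
      (NegaSym a ⇔ NegaSym (prefix (∣⇒≤3 c∣n n≥3) a))
      × (NegaSym a → ∀ (m : Fin n) → 2 * toℕ m + 1 ≡ c →
           (toℕ (a m) ≡ 0 ⊎ 2 * toℕ (a m) ≡ k)))
    × ((a : Tuple k n) →
      (Σ ℕ λ p → Period a p × p ∣ c) →
      (NegaSymCircuit a ⇔ NegaSymCircuit (prefix (∣⇒≤3 c∣n n≥3) a))
      × ((NegaSymCircuit a × CircuitInH a)
          ⇔ (NegaSymCircuit (prefix (∣⇒≤3 c∣n n≥3) a) × CircuitInH (prefix (∣⇒≤3 c∣n n≥3) a))))
lemma2p6 zero k c () _ c∣n
lemma2p6 (suc N) k zero n≥3 _ c∣n with () ← 0∣⇒≡0 c∣n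
lemma2p6 (suc N) k (suc C) n≥3 _ c∣n =
  (λ a step → let periodic = StepInvariant⇒Periodic step in
    prefix-negRev c∣n le periodic periodic , NegaSym-middle c∣n periodic) ,
  (λ { a (p , period@(_ , invariant , _) , p∣c) →
    let periodic = Periodic-∣ p∣c (StepInvariant⇒Periodic (Invariant⇒StepInvariant invariant)) in
    prefix-NegaSymCircuit c∣n le periodic period ,
    (prefix-NegaSymCircuit c∣n le periodic period ×-⇔ prefix-CircuitInH c∣n le periodic period) })
  where
  le : suc C ≤ suc N
  le = ∣⇒≤3 c∣n n≥3
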